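{- Let $A$ be a $-$-game. Write $\mathscr{C}^{\cong}_0(!A)$ for the set of complete symmetry classes of $!A$, $\mathscr{C}^{\cong}_{0,\neq\emptyset}(A)$ for the set of non-empty complete symmetry classes of $A$, and $\mathcal{M}_f(X)$ (resp. $\mathcal{M}_f^{\neq\emptyset}(X)$) for the finite (resp. non-empty finite) multisets on $X$. Define $s^!_A$ on complete configurations of $!A$ by $s^!_A(\emptyset)=[\,]$ and $s^!_A(\parallel_{i\in I}x_i)=[\,\mathsf{x}_i \mid i\in I\,]$ (for $I\subseteq\mathbb N$ finite and all $x_i$ non-empty), where $\mathsf{x}_i$ is the symmetry class of $x_i$ in $A$. Then $s^!_A$ is invariant under symmetry and induces a bijection $$s^!_A:\mathscr{C}^{\cong}_0(!A)\simeq \mathcal{M}_f(\mathscr{C}^{\cong}_{0,\neq\emptyset}(A)),$$ which restricts to a bijection between the non-empty complete symmetry classes of $!A$ and $\mathcal{M}^{\neq\emptyset}_f(\mathscr{C}^{\cong}_{0,\neq\emptyset}(A))$. In particular, if $A$ is moreover strict, this gives a bijection $\mathscr{C}^{\cong}_0(!A)\simeq\mathcal{M}_f(\mathscr{C}^{\cong}_0(A))$.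
   Context: An event structure $E$ consists of a countable set $|E|$ of events, a partial order $\le_E$ (causality) such that $\{e'\mid e'\le_E e\}$ is finite for every $e$, and an irreflexive symmetric relation $\#_E$ (conflict) such that $e_1\#_E e_2\le_E e_2'$ implies $e_1\#_E e_2'$. A (finite) configuration is a finite $x\subseteq|E|$, down-closed for $\le_E$, with no two events in conflict; $\mathscr C(E)$ is the set of configurations. An isomorphism family on $E$ is a set $\tilde E$ of bijections between configurations, containing all identities, closed under composition and inverse, and such that: (restriction) for $\theta:x\simeq y$ in $\tilde E$ and $x'\subseteq x$ with $x'\in\mathscr C(E)$, there is a unique $\theta'\subseteq\theta$ in $\tilde E$ with domain $x'$; (extension) for $\theta:x\simeq y$ in $\tilde E$ and $x\subseteq x'\in\mathscr C(E)$, there is some $\theta'\supseteq\theta$ in $\tilde E$ with domain $x'$. Elements of $\tilde E$ are symmetries, written $\theta:x\cong_E y$; the relation "there is a symmetry $x\cong_E y$" is an equivalence relation whose classes are symmetry classes. A thin concurrent game (tcg) $A$ is an event structure with isomorphism family $\tilde A$, a polarity function $\mathrm{pol}_A:|A|\to\{ -,+\}$ preserved by symmetries, and two isomorphism families $\tilde A_+,\tilde A_-\subseteq\tilde A$ (positive/negative symmetries, written $\cong_A^+,\cong_A^-$) such that every element of $\tilde A_+\cap\tilde A_-$ is an identity, and if $\theta\in\tilde A_-$ (resp. $\tilde A_+$) and $\theta\subseteq\theta'\in\tilde A$ with $\theta'\setminus\theta$ consisting only of pairs of negative (resp. positive) events, then $\theta'\in\tilde A_-$ (resp. $\tilde A_+$).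 A game is a tcg with a payoff $\kappa_A:\mathscr C(A)\to\{ -1,0,+1\}$ invariant under symmetry; configurations and symmetry classes of payoff $0$ are called complete. A configuration $x$ is canonical if every $\theta:x\cong_A x$ factors uniquely as $\theta^+\circ\theta^-$ with $\theta^-:x\cong_A^-x$, $\theta^+:x\cong_A^+x$; games are assumed representable, i.e. equipped with a choice of a canonical representative $\hat{\mathsf x}\in\mathsf x$ for every complete symmetry class $\mathsf x$. A $-$-game is a game whose minimal events are all negative and with $\kappa_A(\emptyset)\ge0$; it is strict if moreover $\kappa_A(\emptyset)=1$ and its minimal events are pairwise in conflict. For a $-$-game $A$, the game $!A$ has events $\mathbb N\times|A|$; $(i,a)\le(j,a')$ iff $i=j$ and $a\le_A a'$; $(i,a)\#(j,a')$ iff $i=j$ and $a\#_A a'$; $\mathrm{pol}(i,a)=\mathrm{pol}_A(a)$. A bijection $\theta$ between configurations of $!A$ is a symmetry iff there are a permutation $\pi$ of $\mathbb N$ and a family $(\theta_n)_{n\in\mathbb N}$ of symmetries of $A$ with $\theta(i,a)=(\pi(i),\theta_i(a))$ for all $(i,a)$ in its domain; it is negative if this holds with all $\theta_n\in\tilde A_-$, and positive if this holds with $\pi$ the identity and all $\theta_n\in\tilde A_+$. Every configuration of $!A$ is uniquely written $\parallel_{i\in I}x_i:=\bigcup_{i\in I}\{i\}\times x_i$ with $I\subseteq\mathbb N$ finite and each $x_i\in\mathscr C(A)$ non-empty. The payoff is $\kappa_{!A}(\emptyset)=0$ and $\kappa_{!A}(\parallel_{i\in I}x_i)=\bigotimes_{i\in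 I}\kappa_A(x_i)$, where $u\otimes v=-1$ if $u=-1$ or $v=-1$, otherwise $+1$ if $u=+1$ or $v=+1$, otherwise $0$. -}

module Defs where

open import Data.Nat using (ℕ)
open import Data.Nat.Properties using () renaming (_≟_ to _≟ℕ_)
open import Data.Product using (Σ; ∃; _×_; _,_; proj₁; proj₂; swap)
open import Data.List using (List; []; _∷_; map; filter; foldr; deduplicate)
open import Data.List.Membership.Propositional using (_∈_)
open import Data.List.Relation.Binary.Subset.Propositional using (_⊆_)
open import Data.List.Relation.Binary.Permutation.Homogeneous using (Permutation)
open import Relation.Binary.PropositionalEquality using (_≡_; _≢_)
open import Relation.Nullary using (¬_)
open import Function.Bundles using (_⇔_; _↔_; Inverse)

data Pay : Set where
  m1 z0 p1 : Pay

_⊗_ : Pay → Pay → Pay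
m1 ⊗ v  = m1
z0 ⊗ v  = v
p1 ⊗ m1 = m1
p1 ⊗ z0 = p1
p1 ⊗ p1 = p1

data Pol : Set where
  neg pos : Pol

-- Finite sets of events are represented by lists (read up to set
-- equality _≐_); bijections between finite sets by their graphs,
-- i.e. finite lists of pairs (again read up to set equality).

_≐_ : {Y : Set} → List Y → List Y → Set
xs ≐ ys = xs ⊆ ys × ys ⊆ xs

Inhabited : {Y : Set} → List Y → Set
Inhabited xs = ∃ λ e → e ∈ xs

module _ {X : Set} where

  Graph : Set
  Graph = List (X × X)

  dom : Graph → List X
  dom = map proj₁

  cod : Graph → List X
  cod = map proj₂

  idG : List X → Graph
  idG = map (λ e → e , e)

  invG : Graph → Graph
  invG = map swap

  IsComposite : Graph → Graph → Graph → Set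
  IsComposite ψ θ θ' =
    ∀ a c → ((a , c) ∈ ψ) ⇔ (∃ λ b → (a , b) ∈ θ × (b , c) ∈ θ')

  IsIdentityG : Graph → Set
  IsIdentityG θ = ∀ {a b} → (a , b) ∈ θ → a ≡ b

  FunctionalG : Graph → Set
  FunctionalG θ = ∀ {a b b'} → (a , b) ∈ θ → (a , b') ∈ θ → b ≡ b'

  InjectiveG : Graph → Set
  InjectiveG θ = ∀ {a a' b} → (a , b) ∈ θ → (a' , b) ∈ θ → a ≡ a'

  Iso : (Graph → Set) → List X → List X → Set
  Iso S x y = ∃ λ θ → S θ × dom θ ≐ x × cod θ ≐ y

  module _ (_≤_ _#_ : X → X → Set) where

    IsConfig : List X → Set
    IsConfig x = (∀ {e e'} → e ∈ x → e' ≤ e → e' ∈ x)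
               × (∀ {e e'} → e ∈ x → e' ∈ x → ¬ (e # e'))

    IsBijection : Graph → Set
    IsBijection θ = IsConfig (dom θ) × IsConfig (cod θ) × FunctionalG θ × InjectiveG θ

    record IsIsoFamily (S : Graph → Set) : Set where
      field
        bij         : ∀ {θ} → S θ → IsBijection θ
        set-ext     : ∀ {θ θ'} → S θ → θ ≐ θ' → S θ'
        identity    : ∀ {x} → IsConfig x → S (idG x)
        inverse     : ∀ {θ} → S θ → S (invG θ)
        compose     : ∀ {θ θ'} → S θ → S θ' → cod θ ≐ dom θ' →
                      ∃ λ ψ → S ψ × IsComposite ψ θ θ'
        restriction : ∀ {θ x'} → S θ → IsConfig x' → x' ⊆ dom θ →
                      ∃ λ θ' → (S θ' × θ' ⊆ θ × dom θ' ≐ x')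
                             × (∀ {θ''} → S θ'' → θ'' ⊆ θ → dom θ'' ≐ x' → θ'' ≐ θ')
        extension   : ∀ {θ x'} → S θ → IsConfig x' → dom θ ⊆ x' →
                      ∃ λ θ' → S θ' × θ ⊆ θ' × dom θ' ≐ x'

record EventStructure : Set₁ where
  field
    Ev        : Set
    enc       : Ev → ℕ                       -- countability
    enc-inj   : ∀ {a b} → enc a ≡ enc b → a ≡ b
    _≤E_      : Ev → Ev → Set
    ≤-refl    : ∀ {a} → a ≤E a
    ≤-trans   : ∀ {a b c} → a ≤E b → b ≤E c → a ≤E c
    ≤-antisym : ∀ {a b} → a ≤E b → b ≤E a → a ≡ b
    ≤-finite  : ∀ e → ∃ λ (l : List Ev) → ∀ {e'} → e' ≤E e → e' ∈ l
    _#E_      : Ev → Ev → Set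
    #-irrefl  : ∀ {a} → ¬ (a #E a)
    #-sym     : ∀ {a b} → a #E b → b #E a
    #-inherit : ∀ {a b c} → a #E b → b ≤E c → a #E c

  IsConf : List Ev → Set
  IsConf = IsConfig _≤E_ _#E_

  Minimal : Ev → Set
  Minimal e = ∀ {e'} → e' ≤E e → e' ≡ e

record TCG : Set₁ where
  field
    ES : EventStructure
  open EventStructure ES public
  field
    Sym     : Graph {Ev} → Set
    Sym⁺    : Graph {Ev} → Set
    Sym⁻    : Graph {Ev} → Set
    sym-fam : IsIsoFamily _≤E_ _#E_ Sym
    pos-fam : IsIsoFamily _≤E_ _#E_ Sym⁺
    neg-fam : IsIsoFamily _≤E_ _#E_ Sym⁻
    pol     : Ev → Pol
    pol-sym : ∀ {θ a b} → Sym θ → (a , b) ∈ θ → pol a ≡ pol b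
    ⁺⊆      : ∀ {θ} → Sym⁺ θ → Sym θ
    ⁻⊆      : ∀ {θ} → Sym⁻ θ → Sym θ
    ⁺⁻-id   : ∀ {θ} → Sym⁺ θ → Sym⁻ θ → IsIdentityG θ
    ⁻-ext   : ∀ {θ θ'} → Sym⁻ θ → Sym θ' → θ ⊆ θ' →
              (∀ {a b} → (a , b) ∈ θ' → ¬ ((a , b) ∈ θ) → pol a ≡ neg × pol b ≡ neg) →
              Sym⁻ θ'
    ⁺-ext   : ∀ {θ θ'} → Sym⁺ θ → Sym θ' → θ ⊆ θ' →
              (∀ {a b} → (a , b) ∈ θ' → ¬ ((a , b) ∈ θ) → pol a ≡ pos × pol b ≡ pos) →
              Sym⁺ θ'

  _≅_ : List Ev → List Ev → Set
  _≅_ = Iso Sym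

  _≅⁺_ : List Ev → List Ev → Set
  _≅⁺_ = Iso Sym⁺

  _≅⁻_ : List Ev → List Ev → Set
  _≅⁻_ = Iso Sym⁻

  Canonical : List Ev → Set
  Canonical x =
    ∀ {θ} → Sym θ → dom θ ≐ x → cod θ ≐ x →
    ∃ λ θ⁻ → ∃ λ θ⁺ →
      (Sym⁻ θ⁻ × dom θ⁻ ≐ x × cod θ⁻ ≐ x × Sym⁺ θ⁺ × dom θ⁺ ≐ x × cod θ⁺ ≐ x
        × IsComposite θ θ⁻ θ⁺)
      × (∀ {φ⁻ φ⁺} → Sym⁻ φ⁻ → dom φ⁻ ≐ x → cod φ⁻ ≐ x →
                     Sym⁺ φ⁺ → dom φ⁺ ≐ x → cod φ⁺ ≐ x →
                     IsComposite θ φ⁻ φ⁺ → φ⁻ ≐ θ⁻ × φ⁺ ≐ θ⁺)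

record Game : Set₁ where
  field
    tcg : TCG
  open TCG tcg public
  field
    κ     : List Ev → Pay
    κ-inv : ∀ {x y} → x ≅ y → κ x ≡ κ y

  Complete : List Ev → Set
  Complete x = κ x ≡ z0

  field
    rep       : (x : List Ev) → IsConf x → Complete x → List Ev
    rep-conf  : ∀ x p c → IsConf (rep x p c)
    rep-sym   : ∀ x p c → x ≅ rep x p c
    rep-canon : ∀ x p c → Canonical (rep x p c)
    rep-class : ∀ x p c y q d → x ≅ y → rep x p c ≐ rep y q d

record MinusGame : Set₁ where
  field
    game : Game
  open Game game public
  field
    min-neg : ∀ e → Minimal e → pol e ≡ neg
    κ∅      : κ [] ≢ m1

Strict : MinusGame → Set
Strict A = κ [] ≡ p1 × (∀ e e' → Minimal e → Minimal e' → e ≢ e' → e #E e')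
  where open MinusGame A

module Bang (A : MinusGame) where
  open MinusGame A public

  Ev! : Set
  Ev! = ℕ × Ev

  _≤!_ : Ev! → Ev! → Set
  (i , a) ≤! (j , b) = i ≡ j × a ≤E b

  _#!_ : Ev! → Ev! → Set
  (i , a) #! (j , b) = i ≡ j × a #E b

  IsConf! : List Ev! → Set
  IsConf! = IsConfig _≤!_ _#!_

  Sym! : Graph {Ev!} → Set
  Sym! θ = IsBijection _≤!_ _#!_ θ
         × Σ (ℕ ↔ ℕ) λ π → Σ (ℕ → Graph {Ev}) λ θs →
             (∀ n → Sym (θs n))
           × (∀ {i a j b} → ((i , a) , (j , b)) ∈ θ → j ≡ Inverse.to π i × (a , b) ∈ θs i)

  _≅!_ : List Ev! → List Ev! → Set
  _≅!_ = Iso Sym!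

  -- the index set I and components x_i of  x = ∥_{i∈I} x_i
  indices : List Ev! → List ℕ
  indices x = deduplicate _≟ℕ_ (map proj₁ x)

  component : List Ev! → ℕ → List Ev
  component x i = map proj₂ (filter (λ e → proj₁ e ≟ℕ i) x)

  s! : List Ev! → List (List Ev)
  s! x = map (component x) (indices x)

  κ! : List Ev! → Pay
  κ! x = foldr _⊗_ z0 (map κ (s! x))

  Complete! : List Ev! → Set
  Complete! x = κ! x ≡ z0

  -- equality of finite multisets of symmetry classes of A
  _≋_ : List (List Ev) → List (List Ev) → Set
  _≋_ = Permutation _≅_

-- A configuration of !A is a finite family of non-empty configurations of A indexed by copy
-- numbers, and s^! forgets the indexing. A symmetry of !A renames copies by a permutation π of ℕ
-- and relates corresponding components by symmetries of A, so x ≅ y iff some π makes each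
-- component x_i symmetric to y_(π i). As the index lists are duplicate-free, such a π amounts to
-- a permutation up to symmetry of the lists of components, i.e. s^! x ≋ s^! y: a permutation up
-- to a partial equivalence splits into a pointwise step and a plain permutation, and a plain
-- permutation of duplicate-free index lists extends to a bijection of ℕ. For surjectivity, the
-- n-th element of a multiset is put in copy n.

module Submission where

open import Defs
open import Data.Product using (∃; _×_)
open import Data.List.Relation.Unary.All using (All)
open import Function.Bundles using (_⇔_)

open import Data.Empty using (⊥-elim)
open import Data.Nat using (ℕ; suc; _≤_; _<_)
open import Data.Nat.Properties using (_≟_; suc-injective)
import Data.Nat.Properties as ℕ
open import Data.Product using (_,_; proj₁; proj₂)
open import Data.Sum using (_⊎_; inj₁; inj₂; [_,_]′)
open import Data.List using (List; []; _∷_; map; _++_; length; foldr; filter; concatMap)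
open import Data.List.Properties
  using (map-∘; map-id; map-cong-local; map-++; ++-identityʳ; filter-all; filter-none; filter-++)
open import Data.List.Membership.Propositional using (_∈_; _∉_; find; lose)
open import Data.List.Membership.Propositional.Properties
  using (∈-map⁺; ∈-map⁻; ∈-++⁻; ∈-concatMap⁺; ∈-concatMap⁻; ∈-map∘filter⁺; ∈-map∘filter⁻;
         ∈-deduplicate⁺; ∈-deduplicate⁻)
open import Data.List.Membership.Propositional.Properties.WithK using (unique∧set⇒bag)
open import Data.List.Membership.DecPropositional _≟_ using (_∈?_)
open import Data.List.Relation.Unary.Any using (here; there)
open import Data.List.Relation.Unary.All using ([]; _∷_)
import Data.List.Relation.Unary.All as All
import Data.List.Relation.Unary.All.Properties as All
open import Data.List.Relation.Unary.AllPairs using ([]; _∷_)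
open import Data.List.Relation.Unary.Unique.Propositional using (Unique)
import Data.List.Relation.Unary.Unique.Propositional.Properties as Unique
open import Data.List.Relation.Unary.Unique.DecPropositional.Properties _≟_ using (deduplicate-!)
open import Data.List.Relation.Binary.Subset.Propositional using (_⊆_)
open import Data.List.Relation.Binary.Subset.Propositional.Properties using (⊆-reflexive; ⊆-trans)
open import Data.List.Relation.Binary.Pointwise using (Pointwise; []; _∷_; Pointwise-length)
import Data.List.Relation.Binary.Pointwise as Pointwise
open import Data.List.Relation.Binary.Permutation.Propositional
  using (_↭_; refl; prep; swap; trans; ↭-sym; ↭-trans; ↭-reflexive; ↭⇒↭ₛ)
open import Data.List.Relation.Binary.Permutation.Propositional.Properties
  using (↭-map-inv; All-resp-↭; ∈-resp-↭)
import Data.List.Relation.Binary.Permutation.Propositional.Properties as ↭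
open import Data.List.Relation.Binary.Permutation.Homogeneous using (Permutation)
import Data.List.Relation.Binary.Permutation.Homogeneous as Perm
open import Data.List.Relation.Binary.BagAndSetEquality using (∼bag⇒↭)
open import Relation.Binary.Core using (Rel)
open import Relation.Binary.Definitions using (Transitive)
open import Relation.Binary.Structures using (IsPartialEquivalence)
open import Relation.Binary.PropositionalEquality
  using (_≡_; _≢_; refl; sym; cong; cong₂; subst; setoid; module ≡-Reasoning)
import Relation.Binary.PropositionalEquality as ≡
open import Data.List.Relation.Binary.Permutation.Setoid.Properties (setoid ℕ) using (Unique-resp-↭)
open import Relation.Nullary using (¬_; Dec; yes; no)
open import Function using (_∘_)
open import Function.Bundles using (_↔_; Inverse; Injection; Equivalence; mk⇔; mk↔ₛ′)
open import Function.Properties.Inverse using (↔⇒↣)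
open import Function.Construct.Composition using (_↔-∘_)
open import Function.Construct.Identity using (↔-id)

module _ {a r} {C : Set a} {R : Rel C r} where

  ↭-Pointwise-commute : ∀ {xs ys zs} → xs ↭ ys → Pointwise R ys zs →
                        ∃ λ ws → Pointwise R xs ws × ws ↭ zs
  ↭-Pointwise-commute refl rs = _ , rs , refl
  ↭-Pointwise-commute (prep x p) (r ∷ rs)
    with _ , rs′ , q ← ↭-Pointwise-commute p rs = _ , r ∷ rs′ , prep _ q
  ↭-Pointwise-commute (swap x y p) (r ∷ r′ ∷ rs)
    with _ , rs′ , q ← ↭-Pointwise-commute p rs = _ , r′ ∷ r ∷ rs′ , swap _ _ q
  ↭-Pointwise-commute (trans p q) rs
    with _ , rs′ , q′ ← ↭-Pointwise-commute q rs
    with _ , rs″ , p′ ← ↭-Pointwise-commute p rs′ = _ , rs″ , trans p′ q′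

  Permutation⇒Pointwise∘↭ : Transitive R → ∀ {xs ys} → Permutation R xs ys →
                            ∃ λ zs → Pointwise R xs zs × zs ↭ ys
  Permutation⇒Pointwise∘↭ R-trans (Perm.refl rs) = _ , rs , refl
  Permutation⇒Pointwise∘↭ R-trans (Perm.prep r p)
    with _ , rs , q ← Permutation⇒Pointwise∘↭ R-trans p = _ , r ∷ rs , prep _ q
  Permutation⇒Pointwise∘↭ R-trans (Perm.swap r r′ p)
    with _ , rs , q ← Permutation⇒Pointwise∘↭ R-trans p = _ , r ∷ r′ ∷ rs , swap _ _ q
  Permutation⇒Pointwise∘↭ R-trans (Perm.trans p q)
    with _ , rs , p′ ← Permutation⇒Pointwise∘↭ R-trans p
    with _ , ss , q′ ← Permutation⇒Pointwise∘↭ R-trans q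
    with _ , rs′ , p″ ← ↭-Pointwise-commute p′ ss
    = _ , Pointwise.transitive R-trans rs rs′ , trans p″ q′

  ↭⇒Permutation : ∀ {xs ys} → All (λ x → R x x) xs → xs ↭ ys → Permutation R xs ys
  ↭⇒Permutation rs refl = Perm.refl (Pointwise-diagonal rs)
    where
    Pointwise-diagonal : ∀ {xs} → All (λ x → R x x) xs → Pointwise R xs xs
    Pointwise-diagonal [] = []
    Pointwise-diagonal (r ∷ rs) = r ∷ Pointwise-diagonal rs
  ↭⇒Permutation (r ∷ rs) (prep x p) = Perm.prep r (↭⇒Permutation rs p)
  ↭⇒Permutation (r ∷ r′ ∷ rs) (swap x y p) = Perm.swap r r′ (↭⇒Permutation rs p)
  ↭⇒Permutation rs (trans p q) =
    Perm.trans (↭⇒Permutation rs p) (↭⇒Permutation (All-resp-↭ p rs) q)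

transpose : ℕ → ℕ → ℕ → ℕ
transpose a b n with n ≟ a
... | yes _ = b
... | no _ with n ≟ b
...   | yes _ = a
...   | no _ = n

transpose-left : ∀ a b → transpose a b a ≡ b
transpose-left a b with a ≟ a
... | yes _ = refl
... | no a≢a = ⊥-elim (a≢a refl)

transpose-other : ∀ {a b n} → n ≢ a → n ≢ b → transpose a b n ≡ n
transpose-other {a} {b} {n} n≢a n≢b with n ≟ a
... | yes n≡a = ⊥-elim (n≢a n≡a)
... | no _ with n ≟ b
...   | yes n≡b = ⊥-elim (n≢b n≡b)
...   | no _ = refl

transpose-right : ∀ a b → transpose a b b ≡ a
transpose-right a b with b ≟ a
... | yes b≡a = b≡a
... | no _ with b ≟ b
...   | yes _ = refl
...   | no b≢b = ⊥-elim (b≢b refl)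

transpose-involutive : ∀ a b n → transpose a b (transpose a b n) ≡ n
transpose-involutive a b n with n ≟ a
... | yes refl = transpose-right a b
... | no n≢a with n ≟ b
...   | yes refl = transpose-left a b
...   | no n≢b = transpose-other n≢a n≢b

transposition : ℕ → ℕ → ℕ ↔ ℕ
transposition a b =
  mk↔ₛ′ (transpose a b) (transpose a b) (transpose-involutive a b) (transpose-involutive a b)

↔-injective : ∀ (π : ℕ ↔ ℕ) {m n} → Inverse.to π m ≡ Inverse.to π n → m ≡ n
↔-injective π = Injection.injective (↔⇒↣ π)

∃↔-mapping : ∀ {I J : List ℕ} → Unique I → Unique J → length I ≡ length J →
             ∃ λ (π : ℕ ↔ ℕ) → map (Inverse.to π) I ≡ J
∃↔-mapping {[]} {[]} _ _ _ = ↔-id ℕ , refl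
∃↔-mapping {i ∷ I} {j ∷ J} (i∉I ∷ uI) (j∉J ∷ uJ) |I|≡|J|
  with π , refl ← ∃↔-mapping uI uJ (suc-injective |I|≡|J|)
  = transposition (to i) j ↔-∘ π
  , cong₂ _∷_ (transpose-left (to i) j) (map-cong-local (All.tabulate fixed))
  where
  open Inverse π using (to)
  fixed : ∀ {k} → k ∈ I → transpose (to i) j (to k) ≡ to k
  fixed k∈I = transpose-other (λ e → All.lookup i∉I k∈I (sym (↔-injective π e)))
                              (λ e → All.lookup j∉J (∈-map⁺ to k∈I) (sym e))

module _ {a b r} {A : Set a} {B : Set b} {S : A → B → Set r} {h : A → B} where

  All⇒Pointwise-map : ∀ {xs} → All (λ x → S x (h x)) xs → Pointwise S xs (map h xs)
  All⇒Pointwise-map [] = []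
  All⇒Pointwise-map (s ∷ ss) = s ∷ All⇒Pointwise-map ss

  Pointwise-map⇒All : ∀ {xs} → Pointwise S xs (map h xs) → All (λ x → S x (h x)) xs
  Pointwise-map⇒All {[]} [] = []
  Pointwise-map⇒All {_ ∷ _} (s ∷ ss) = s ∷ Pointwise-map⇒All ss

module _ {a r} {C : Set a} {R : Rel C r} (R-per : IsPartialEquivalence R) where
  open IsPartialEquivalence R-per renaming (sym to R-sym; trans to R-trans)

  Pointwise-reflexiveʳ : ∀ {xs ys} → Pointwise R xs ys → All (λ y → R y y) ys
  Pointwise-reflexiveʳ [] = []
  Pointwise-reflexiveʳ (r ∷ rs) = R-trans (R-sym r) r ∷ Pointwise-reflexiveʳ rs

module _ {a r} {C : Set a} {R : Rel C r} (R-per : IsPartialEquivalence R) (f g : ℕ → C) where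
  open IsPartialEquivalence R-per renaming (trans to R-trans)

  reindexing⇒Permutation : ∀ (π : ℕ ↔ ℕ) {I J} → All (λ i → R (f i) (g (Inverse.to π i))) I →
                           map (Inverse.to π) I ↭ J → Permutation R (map f I) (map g J)
  reindexing⇒Permutation π {I} rs p =
    Perm.trans (Perm.refl pw) (↭⇒Permutation (Pointwise-reflexiveʳ R-per pw) (↭.map⁺ g p))
    where
    pw : Pointwise R (map f I) (map g (map (Inverse.to π) I))
    pw = Pointwise.map⁺ f g (All⇒Pointwise-map rs)

  Permutation⇒reindexing : ∀ {I J} → Unique I → Unique J → Permutation R (map f I) (map g J) →
                           ∃ λ (π : ℕ ↔ ℕ) → All (λ i → R (f i) (g (Inverse.to π i))) I
                                           × map (Inverse.to π) I ↭ J
  Permutation⇒reindexing uI uJ P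
    with _ , rs , p ← Permutation⇒Pointwise∘↭ R-trans P
    with _ , refl , J↭J′ ← ↭-map-inv g (↭-sym p)
    with pw ← Pointwise.map⁻ f g rs
    with π , refl ← ∃↔-mapping uI (Unique-resp-↭ (↭⇒↭ₛ J↭J′) uJ) (Pointwise-length pw)
    = π , Pointwise-map⇒All pw , ↭-sym J↭J′

module _ {X : Set} where

  ≐-sym : {x y : List X} → x ≐ y → y ≐ x
  ≐-sym (x⊆y , y⊆x) = y⊆x , x⊆y

  ≐-trans : {x y z : List X} → x ≐ y → y ≐ z → x ≐ z
  ≐-trans (x⊆y , y⊆x) (y⊆z , z⊆y) = ⊆-trans x⊆y y⊆z , ⊆-trans z⊆y y⊆x

  ≡⇒≐ : {x y : List X} → x ≡ y → x ≐ y
  ≡⇒≐ x≡y = ⊆-reflexive x≡y , ⊆-reflexive (sym x≡y)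

  ∈-dom⁺ : ∀ {θ : Graph {X}} {a b} → (a , b) ∈ θ → a ∈ dom θ
  ∈-dom⁺ = ∈-map⁺ proj₁

  ∈-cod⁺ : ∀ {θ : Graph {X}} {a b} → (a , b) ∈ θ → b ∈ cod θ
  ∈-cod⁺ = ∈-map⁺ proj₂

  ∈-dom⁻ : ∀ {θ : Graph {X}} {a} → a ∈ dom θ → ∃ λ b → (a , b) ∈ θ
  ∈-dom⁻ a∈ with (_ , b) , ab , refl ← ∈-map⁻ proj₁ a∈ = b , ab

  ∈-cod⁻ : ∀ {θ : Graph {X}} {b} → b ∈ cod θ → ∃ λ a → (a , b) ∈ θ
  ∈-cod⁻ b∈ with (a , _) , ab , refl ← ∈-map⁻ proj₂ b∈ = a , ab

  dom-idG : (x : List X) → dom (idG x) ≡ x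
  dom-idG x = ≡.trans (sym (map-∘ x)) (map-id x)

  cod-idG : (x : List X) → cod (idG x) ≡ x
  cod-idG x = ≡.trans (sym (map-∘ x)) (map-id x)

  dom-invG : (θ : Graph {X}) → dom (invG θ) ≡ cod θ
  dom-invG θ = sym (map-∘ θ)

  cod-invG : (θ : Graph {X}) → cod (invG θ) ≡ dom θ
  cod-invG θ = sym (map-∘ θ)

  dom-composite : ∀ {ψ θ θ′ : Graph {X}} → IsComposite ψ θ θ′ → cod θ ⊆ dom θ′ →
                  dom ψ ≐ dom θ
  dom-composite {θ = θ} ψ≡θ′∘θ cod⊆dom = dom⊆ , ⊆dom
    where
    dom⊆ : dom _ ⊆ dom θ
    dom⊆ a∈ with c , ac ← ∈-dom⁻ a∈
            with _ , ab , _ ← Equivalence.to (ψ≡θ′∘θ _ c) ac = ∈-dom⁺ ab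
    ⊆dom : dom θ ⊆ dom _
    ⊆dom a∈ with b , ab ← ∈-dom⁻ a∈ with c , bc ← ∈-dom⁻ (cod⊆dom (∈-cod⁺ ab)) =
      ∈-dom⁺ (Equivalence.from (ψ≡θ′∘θ _ c) (b , ab , bc))

  cod-composite : ∀ {ψ θ θ′ : Graph {X}} → IsComposite ψ θ θ′ → dom θ′ ⊆ cod θ →
                  cod ψ ≐ cod θ′
  cod-composite {θ′ = θ′} ψ≡θ′∘θ dom⊆cod = cod⊆ , ⊆cod
    where
    cod⊆ : cod _ ⊆ cod θ′
    cod⊆ c∈ with a , ac ← ∈-cod⁻ c∈
            with _ , _ , bc ← Equivalence.to (ψ≡θ′∘θ a _) ac = ∈-cod⁺ bc
    ⊆cod : cod θ′ ⊆ cod _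
    ⊆cod c∈ with b , bc ← ∈-cod⁻ c∈ with a , ab ← ∈-cod⁻ (dom⊆cod (∈-dom⁺ bc)) =
      ∈-cod⁺ (Equivalence.from (ψ≡θ′∘θ a _) (b , ab , bc))

  Iso-Inhabited : ∀ {S : Graph {X} → Set} {x y} → Iso S x y → Inhabited x → Inhabited y
  Iso-Inhabited (θ , _ , (_ , x⊆dom) , (cod⊆y , _)) (a , a∈x)
    with b , ab ← ∈-dom⁻ (x⊆dom a∈x) = b , cod⊆y (∈-cod⁺ ab)

  ¬Inhabited⇒≡[] : {x : List X} → ¬ Inhabited x → x ≡ []
  ¬Inhabited⇒≡[] {[]} _ = refl
  ¬Inhabited⇒≡[] {a ∷ x} ¬inh with () ← ¬inh (a , here refl)

  module _ {_≤_ _#_ : X → X → Set} where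

    IsConfig-resp-≐ : ∀ {x y} → IsConfig _≤_ _#_ x → x ≐ y → IsConfig _≤_ _#_ y
    IsConfig-resp-≐ (down-closed , conflict-free) (x⊆y , y⊆x) =
      (λ e∈y e′≤e → x⊆y (down-closed (y⊆x e∈y) e′≤e)) ,
      (λ e∈y e′∈y → conflict-free (y⊆x e∈y) (y⊆x e′∈y))

    IsConfig-[] : IsConfig _≤_ _#_ []
    IsConfig-[] = (λ ()) , (λ ())

module SymmetryProperties (T : TCG) where
  open TCG T
  open IsIsoFamily sym-fam

  Sym-functional : ∀ {θ} → Sym θ → FunctionalG θ
  Sym-functional s = proj₁ (proj₂ (proj₂ (bij s)))

  Sym-injective : ∀ {θ} → Sym θ → InjectiveG θ
  Sym-injective s = proj₂ (proj₂ (proj₂ (bij s)))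

  ≅-refl : ∀ {x} → IsConf x → x ≅ x
  ≅-refl {x} cx = idG x , identity cx , ≡⇒≐ (dom-idG x) , ≡⇒≐ (cod-idG x)

  ≅-sym : ∀ {x y} → x ≅ y → y ≅ x
  ≅-sym (θ , s , dθ , cθ) =
    invG θ , inverse s , ≐-trans (≡⇒≐ (dom-invG θ)) cθ , ≐-trans (≡⇒≐ (cod-invG θ)) dθ

  ≅-trans : ∀ {x y z} → x ≅ y → y ≅ z → x ≅ z
  ≅-trans (θ , s , dθ , cθ) (θ′ , s′ , dθ′ , cθ′) =
    let ψ , sψ , ψ≡θ′∘θ = compose s s′ cθ≐dθ′
    in ψ , sψ , ≐-trans (dom-composite ψ≡θ′∘θ (proj₁ cθ≐dθ′)) dθ
              , ≐-trans (cod-composite ψ≡θ′∘θ (proj₂ cθ≐dθ′)) cθ′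
    where
    cθ≐dθ′ : cod θ ≐ dom θ′
    cθ≐dθ′ = ≐-trans cθ (≐-sym dθ′)

  -- _≅_ is reflexive only on configurations.
  ≅-isPartialEquivalence : IsPartialEquivalence _≅_
  ≅-isPartialEquivalence = record { sym = ≅-sym ; trans = ≅-trans }

  ≅-empty : ∀ {x y} → ¬ Inhabited x → ¬ Inhabited y → x ≅ y
  ≅-empty ¬x ¬y rewrite ¬Inhabited⇒≡[] ¬x | ¬Inhabited⇒≡[] ¬y = ≅-refl IsConfig-[]

  Sym-restrict-≅ : ∀ {φ x y} → Sym φ → IsConf x →
                   (∀ {a} → a ∈ x → ∃ λ b → (a , b) ∈ φ × b ∈ y) →
                   (∀ {b} → b ∈ y → ∃ λ a → (a , b) ∈ φ × a ∈ x) → x ≅ y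
  Sym-restrict-≅ {φ} {x} {y} sφ cx x→y y→x
    with θ , (sθ , θ⊆φ , dθ) , _ ← restriction sφ cx (∈-dom⁺ ∘ proj₁ ∘ proj₂ ∘ x→y)
    = θ , sθ , dθ , cod⊆ , ⊆cod
    where
    cod⊆ : cod θ ⊆ y
    cod⊆ b∈ with a , ab ← ∈-cod⁻ b∈
            with _ , ab′ , b′∈y ← x→y (proj₁ dθ (∈-dom⁺ ab))
            with refl ← Sym-functional sφ (θ⊆φ ab) ab′ = b′∈y
    ⊆cod : y ⊆ cod θ
    ⊆cod b∈y with a , ab , a∈x ← y→x b∈y
             with _ , ab′ ← ∈-dom⁻ (proj₂ dθ a∈x)
             with refl ← Sym-functional sφ (θ⊆φ ab′) ab = ∈-cod⁺ ab′

⊗-complete⁻ : ∀ u v → u ⊗ v ≡ z0 → u ≡ z0 × v ≡ z0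
⊗-complete⁻ z0 v v≡z0 = refl , v≡z0
⊗-complete⁻ m1 v ()
⊗-complete⁻ p1 m1 ()
⊗-complete⁻ p1 z0 ()
⊗-complete⁻ p1 p1 ()

⨂-complete : ∀ us → foldr _⊗_ z0 us ≡ z0 ⇔ All (_≡ z0) us
⨂-complete us = mk⇔ (to us) from
  where
  to : ∀ us → foldr _⊗_ z0 us ≡ z0 → All (_≡ z0) us
  to [] _ = []
  to (u ∷ us) ⨂≡z0 with u≡z0 , us≡z0 ← ⊗-complete⁻ u _ ⨂≡z0 = u≡z0 ∷ to us us≡z0
  from : ∀ {us} → All (_≡ z0) us → foldr _⊗_ z0 us ≡ z0
  from [] = refl
  from (refl ∷ us≡z0) = from us≡z0

module Components (A : MinusGame) where
  open Bang A

  in-copy? : ∀ i (e : Ev!) → Dec (proj₁ e ≡ i)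
  in-copy? i e = proj₁ e ≟ i

  ∈-component⁺ : ∀ {x i a} → (i , a) ∈ x → a ∈ component x i
  ∈-component⁺ ia∈x = ∈-map∘filter⁺ proj₂ (in-copy? _) (_ , ia∈x , refl , refl)

  ∈-component⁻ : ∀ {x i a} → a ∈ component x i → (i , a) ∈ x
  ∈-component⁻ {x} {i} a∈
    with _ , ia∈x , refl , refl ← ∈-map∘filter⁻ proj₂ (in-copy? i) {xs = x} a∈ = ia∈x

  ∈-indices⁺ : ∀ {x i a} → (i , a) ∈ x → i ∈ indices x
  ∈-indices⁺ ia∈x = ∈-deduplicate⁺ _≟_ (∈-map⁺ proj₁ ia∈x)

  Inhabited⇒∈-indices : ∀ {x i} → Inhabited (component x i) → i ∈ indices x
  Inhabited⇒∈-indices (_ , a∈) = ∈-indices⁺ (∈-component⁻ a∈)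

  ∈-indices⇒Inhabited : ∀ {x i} → i ∈ indices x → Inhabited (component x i)
  ∈-indices⇒Inhabited {x} i∈
    with (_ , a) , ia∈x , refl ← ∈-map⁻ proj₁ (∈-deduplicate⁻ _≟_ (map proj₁ x) i∈)
    = a , ∈-component⁺ ia∈x

  indices-unique : ∀ x → Unique (indices x)
  indices-unique x = deduplicate-! (map proj₁ x)

  component-IsConf : ∀ {x} → IsConf! x → ∀ i → IsConf (component x i)
  component-IsConf (down-closed , conflict-free) i =
    (λ a∈ a′≤a → ∈-component⁺ (down-closed (∈-component⁻ a∈) (refl , a′≤a))) ,
    (λ a∈ a′∈ a#a′ → conflict-free (∈-component⁻ a∈) (∈-component⁻ a′∈) (refl , a#a′))

  components-IsConf! : ∀ {x} → (∀ i → IsConf (component x i)) → IsConf! x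
  components-IsConf! conf =
    (λ { {i , _} e∈ (refl , e′≤e) →
           ∈-component⁻ (proj₁ (conf i) (∈-component⁺ e∈) e′≤e) }) ,
    (λ { {i , _} e∈ e′∈ (refl , e#e′) →
           proj₂ (conf i) (∈-component⁺ e∈) (∈-component⁺ e′∈) e#e′ })

  Inhabited⇔Inhabited-s! : ∀ x → Inhabited x ⇔ Inhabited (s! x)
  Inhabited⇔Inhabited-s! x = mk⇔
    (λ ((i , _) , e∈) → component x i , ∈-map⁺ (component x) (∈-indices⁺ e∈))
    (λ (_ , c∈) → let i , i∈ , _ = ∈-map⁻ (component x) c∈
                      a , a∈ = ∈-indices⇒Inhabited i∈
                  in (i , a) , ∈-component⁻ a∈)

  Complete!⇔components-Complete : ∀ {x} → Complete! x ⇔ All Complete (s! x)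
  Complete!⇔components-Complete {x} =
    mk⇔ (λ k → All.map⁻ (Equivalence.to (⨂-complete _) k))
        (λ ks → Equivalence.from (⨂-complete _) (All.map⁺ ks))

  components-valid : ∀ {x} → IsConf! x → Complete! x →
                     All (λ c → IsConf c × Inhabited c × Complete c) (s! x)
  components-valid {x} cx kx = All.tabulate valid
    where
    valid : ∀ {c} → c ∈ s! x → IsConf c × Inhabited c × Complete c
    valid c∈ with i , i∈ , refl ← ∈-map⁻ (component x) c∈ =
      component-IsConf cx i , ∈-indices⇒Inhabited i∈ ,
      All.lookup (Equivalence.to Complete!⇔components-Complete kx) c∈

module Symmetries (A : MinusGame) where
  open Bang A
  open Components A
  open SymmetryProperties tcg

  Componentwise≅ : ℕ ↔ ℕ → List Ev! → List Ev! → Set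
  Componentwise≅ π x y = ∀ i → component x i ≅ component y (Inverse.to π i)

  -- The symmetry θs i of A carried by a symmetry of !A may act beyond its i-th block.
  ≅!⇒Componentwise≅ : ∀ {x y} → IsConf! x → x ≅! y → ∃ λ π → Componentwise≅ π x y
  ≅!⇒Componentwise≅ {x} {y} cx (θ , (_ , π , θs , θs-sym , tracks) , dθ , cθ) =
    π , λ i → Sym-restrict-≅ (θs-sym i) (component-IsConf cx i) (forth i) (back i)
    where
    open Inverse π using (to)
    forth : ∀ i {a} → a ∈ component x i → ∃ λ b → (a , b) ∈ θs i × b ∈ component y (to i)
    forth i a∈ with _ , ab∈θ ← ∈-dom⁻ (proj₂ dθ (∈-component⁻ a∈))
               with refl , ab∈θi ← tracks ab∈θ
      = _ , ab∈θi , ∈-component⁺ (proj₁ cθ (∈-cod⁺ ab∈θ))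
    back : ∀ i {b} → b ∈ component y (to i) → ∃ λ a → (a , b) ∈ θs i × a ∈ component x i
    back i b∈ with _ , ab∈θ ← ∈-cod⁻ (proj₂ cθ (∈-component⁻ b∈))
              with to-i≡to-i′ , ab∈θi′ ← tracks ab∈θ
              with refl ← ↔-injective π to-i≡to-i′
      = _ , ab∈θi′ , ∈-component⁺ (proj₁ dθ (∈-dom⁺ ab∈θ))

  Componentwise≅⇒≅! : ∀ {π x y} → IsConf! x → IsConf! y → Componentwise≅ π x y → x ≅! y
  Componentwise≅⇒≅! {π} {x} {y} cx cy iso =
    θ , (bijective , π , θs , θs-sym , tracks) , dθ , cθ
    where
    open Inverse π using (to; from; strictlyInverseˡ)
    θs : ℕ → Graph {Ev}
    θs i = proj₁ (iso i)
    θs-sym : ∀ i → Sym (θs i)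
    θs-sym i = proj₁ (proj₂ (iso i))
    dom-θs : ∀ i → dom (θs i) ≐ component x i
    dom-θs i = proj₁ (proj₂ (proj₂ (iso i)))
    cod-θs : ∀ i → cod (θs i) ≐ component y (to i)
    cod-θs i = proj₂ (proj₂ (proj₂ (iso i)))
    block : ℕ → Graph {Ev!}
    block i = map (λ (a , b) → (i , a) , (to i , b)) (θs i)
    θ : Graph {Ev!}
    θ = concatMap block (indices x)

    ∈θ⁺ : ∀ {i a b} → i ∈ indices x → (a , b) ∈ θs i → ((i , a) , (to i , b)) ∈ θ
    ∈θ⁺ i∈ ab∈ = ∈-concatMap⁺ block (lose i∈ (∈-map⁺ _ ab∈))
    tracks : ∀ {i a j b} → ((i , a) , (j , b)) ∈ θ → j ≡ to i × (a , b) ∈ θs i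
    tracks p with _ , _ , q ← find (∈-concatMap⁻ block {indices x} p)
             with _ , ab∈ , refl ← ∈-map⁻ _ q = refl , ab∈

    dθ : dom θ ≐ x
    dθ = dom⊆ , ⊆dom
      where
      dom⊆ : dom θ ⊆ x
      dom⊆ e∈ with _ , p ← ∈-dom⁻ e∈ with refl , ab∈ ← tracks p
        = ∈-component⁻ (proj₁ (dom-θs _) (∈-dom⁺ ab∈))
      ⊆dom : x ⊆ dom θ
      ⊆dom e∈ with _ , ab∈ ← ∈-dom⁻ (proj₂ (dom-θs _) (∈-component⁺ e∈))
        = ∈-dom⁺ (∈θ⁺ (∈-indices⁺ e∈) ab∈)

    cθ : cod θ ≐ y
    cθ = cod⊆ , ⊆cod
      where
      cod⊆ : cod θ ⊆ y
      cod⊆ e∈ with _ , p ← ∈-cod⁻ e∈ with refl , ab∈ ← tracks p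
        = ∈-component⁻ (proj₁ (cod-θs _) (∈-cod⁺ ab∈))
      ⊆cod : y ⊆ cod θ
      ⊆cod {j , b} e∈
        with _ , ab∈ ← ∈-cod⁻ (proj₂ (cod-θs (from j)) (subst (λ k → b ∈ component y k)
                                                              (sym (strictlyInverseˡ j))
                                                              (∈-component⁺ e∈)))
        = subst (λ k → (k , b) ∈ cod θ) (strictlyInverseˡ j) (∈-cod⁺ (∈θ⁺ from-j∈ ab∈))
        where
        from-j∈ : from j ∈ indices x
        from-j∈ = ∈-indices⁺ (∈-component⁻ (proj₁ (dom-θs (from j)) (∈-dom⁺ ab∈)))

    bijective : IsBijection _≤!_ _#!_ θ
    bijective =
      IsConfig-resp-≐ cx (≐-sym dθ) , IsConfig-resp-≐ cy (≐-sym cθ) , functional , injective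
      where
      functional : FunctionalG θ
      functional p q with refl , ab∈ ← tracks p with refl , ab′∈ ← tracks q
                     with refl ← Sym-functional (θs-sym _) ab∈ ab′∈ = refl
      injective : InjectiveG θ
      injective p q with j≡to-i , ab∈ ← tracks p with j≡to-i′ , a′b∈ ← tracks q
                    with refl ← ↔-injective π (≡.trans (sym j≡to-i) j≡to-i′)
                    with refl ← Sym-injective (θs-sym _) ab∈ a′b∈ = refl

  Componentwise≅-indices : ∀ {π x y} → Componentwise≅ π x y →
                           ∀ i → i ∈ indices x ⇔ Inverse.to π i ∈ indices y
  Componentwise≅-indices iso i = mk⇔
    (Inhabited⇒∈-indices ∘ Iso-Inhabited (iso i) ∘ ∈-indices⇒Inhabited)
    (Inhabited⇒∈-indices ∘ Iso-Inhabited (≅-sym (iso i)) ∘ ∈-indices⇒Inhabited)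

  Componentwise≅⇒reindexing : ∀ {π x y} → Componentwise≅ π x y →
    All (λ i → component x i ≅ component y (Inverse.to π i)) (indices x)
    × map (Inverse.to π) (indices x) ↭ indices y
  Componentwise≅⇒reindexing {π} {x} {y} iso =
    All.tabulate (λ _ → iso _) ,
    ∼bag⇒↭ (unique∧set⇒bag (Unique.map⁺ (↔-injective π) (indices-unique x)) (indices-unique y)
                          (mk⇔ forth back))
    where
    open Inverse π using (to; from; strictlyInverseˡ)
    forth : ∀ {j} → j ∈ map to (indices x) → j ∈ indices y
    forth j∈ with i , i∈ , refl ← ∈-map⁻ to j∈ =
      Equivalence.to (Componentwise≅-indices {π} {x} {y} iso i) i∈
    back : ∀ {j} → j ∈ indices y → j ∈ map to (indices x)
    back {j} j∈ = subst (_∈ map to (indices x)) (strictlyInverseˡ j)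
      (∈-map⁺ to (Equivalence.from (Componentwise≅-indices {π} {x} {y} iso (from j))
                    (subst (_∈ indices y) (sym (strictlyInverseˡ j)) j∈)))

  reindexing⇒Componentwise≅ : ∀ {π x y} →
    All (λ i → component x i ≅ component y (Inverse.to π i)) (indices x) →
    map (Inverse.to π) (indices x) ↭ indices y → Componentwise≅ π x y
  reindexing⇒Componentwise≅ {π} {x} {y} isos I↭J i with i ∈? indices x
  ... | yes i∈ = All.lookup isos i∈
  ... | no i∉ = ≅-empty (i∉ ∘ Inhabited⇒∈-indices) (to-i∉ ∘ Inhabited⇒∈-indices)
    where
    to-i∉ : Inverse.to π i ∉ indices y
    to-i∉ to-i∈ with _ , i′∈ , to-i≡to-i′ ← ∈-map⁻ _ (∈-resp-↭ (↭-sym I↭J) to-i∈)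
                with refl ← ↔-injective π to-i≡to-i′ = i∉ i′∈

  ≅!⇒≋ : ∀ {x y} → IsConf! x → x ≅! y → s! x ≋ s! y
  ≅!⇒≋ {x} {y} cx x≅y =
    let π , iso = ≅!⇒Componentwise≅ cx x≅y
        isos , I↭J = Componentwise≅⇒reindexing {π} {x} {y} iso
    in reindexing⇒Permutation ≅-isPartialEquivalence (component x) (component y) π isos I↭J

  ≋⇒≅! : ∀ {x y} → IsConf! x → IsConf! y → s! x ≋ s! y → x ≅! y
  ≋⇒≅! {x} {y} cx cy s!x≋s!y =
    let π , isos , I↭J = Permutation⇒reindexing ≅-isPartialEquivalence (component x) (component y)
                            (indices-unique x) (indices-unique y) s!x≋s!y
    in Componentwise≅⇒≅! {π} cx cy (reindexing⇒Componentwise≅ {π} {x} {y} isos I↭J)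

module Tagging (A : MinusGame) where
  open Bang A
  open Components A
  open SymmetryProperties tcg

  tag : ℕ → List (List Ev) → List Ev!
  tag k [] = []
  tag k (c ∷ cs) = map (k ,_) c ++ tag (suc k) cs

  positions : ℕ → List (List Ev) → List ℕ
  positions k [] = []
  positions k (_ ∷ cs) = k ∷ positions (suc k) cs

  positions-≥ : ∀ {k j} ms → j ∈ positions k ms → k ≤ j
  positions-≥ (_ ∷ _) (here refl) = ℕ.≤-refl
  positions-≥ (_ ∷ cs) (there j∈) = ℕ.<⇒≤ (positions-≥ cs j∈)

  positions-unique : ∀ k ms → Unique (positions k ms)
  positions-unique k [] = []
  positions-unique k (_ ∷ cs) =
    All.tabulate (λ j∈ k≡j → ℕ.<-irrefl k≡j (positions-≥ cs j∈)) ∷ positions-unique (suc k) cs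

  tag-positions : ∀ {k j a} ms → (j , a) ∈ tag k ms → j ∈ positions k ms
  tag-positions (c ∷ cs) ja∈ with ∈-++⁻ (map _ c) ja∈
  ... | inj₁ ja∈block with _ , _ , refl ← ∈-map⁻ _ ja∈block = here refl
  ... | inj₂ ja∈rest = there (tag-positions cs ja∈rest)

  component-++ : ∀ xs ys j → component (xs ++ ys) j ≡ component xs j ++ component ys j
  component-++ xs ys j = ≡.trans (cong (map proj₂) (filter-++ (in-copy? j) xs ys))
                                 (map-++ proj₂ (filter (in-copy? j) xs) _)

  component-block : ∀ k (c : List Ev) → component (map (k ,_) c) k ≡ c
  component-block k c = begin
    map proj₂ (filter (in-copy? k) (map (k ,_) c))
      ≡⟨ cong (map proj₂) (filter-all (in-copy? k) (All.map⁺ (All.tabulate λ _ → refl))) ⟩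
    map proj₂ (map (k ,_) c)  ≡⟨ sym (map-∘ c) ⟩
    map (λ a → a) c           ≡⟨ map-id c ⟩
    c                         ∎
    where open ≡-Reasoning

  component-block-≢ : ∀ {j k} (c : List Ev) → j ≢ k → component (map (k ,_) c) j ≡ []
  component-block-≢ {j} c j≢k =
    cong (map proj₂) (filter-none (in-copy? j)
                                  (All.map⁺ {xs = c} (All.tabulate λ _ k≡j → j≢k (sym k≡j))))

  component-tag-< : ∀ {j k} ms → j < k → component (tag k ms) j ≡ []
  component-tag-< ms j<k = ¬Inhabited⇒≡[] λ (_ , a∈) →
    ℕ.<⇒≱ j<k (positions-≥ ms (tag-positions ms (∈-component⁻ a∈)))

  component-tag-head : ∀ k c cs → component (tag k (c ∷ cs)) k ≡ c
  component-tag-head k c cs = begin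
    component (map (k ,_) c ++ tag (suc k) cs) k             ≡⟨ component-++ (map (k ,_) c) _ k ⟩
    component (map (k ,_) c) k ++ component (tag (suc k) cs) k
      ≡⟨ cong₂ _++_ (component-block k c) (component-tag-< cs ℕ.≤-refl) ⟩
    c ++ []                                                   ≡⟨ ++-identityʳ c ⟩
    c                                                         ∎
    where open ≡-Reasoning

  component-tag-tail : ∀ {j} k c cs → j ≢ k →
                       component (tag k (c ∷ cs)) j ≡ component (tag (suc k) cs) j
  component-tag-tail {j} k c cs j≢k =
    ≡.trans (component-++ (map (k ,_) c) _ j) (cong (_++ _) (component-block-≢ c j≢k))

  components-tag : ∀ k ms → map (component (tag k ms)) (positions k ms) ≡ ms
  components-tag k [] = refl
  components-tag k (c ∷ cs) = cong₂ _∷_ (component-tag-head k c cs) (begin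
    map (component (tag k (c ∷ cs))) (positions (suc k) cs)
      ≡⟨ map-cong-local (All.tabulate λ j∈ → component-tag-tail k c cs λ j≡k →
                           ℕ.<-irrefl (sym j≡k) (positions-≥ cs j∈)) ⟩
    map (component (tag (suc k) cs)) (positions (suc k) cs)  ≡⟨ components-tag (suc k) cs ⟩
    cs                                                        ∎)
    where open ≡-Reasoning

  component-tag-∈ : ∀ k ms j → component (tag k ms) j ≡ [] ⊎ component (tag k ms) j ∈ ms
  component-tag-∈ k [] j = inj₁ refl
  component-tag-∈ k (c ∷ cs) j with j ≟ k
  ... | yes refl = inj₂ (here (component-tag-head k c cs))
  ... | no j≢k rewrite component-tag-tail k c cs j≢k with component-tag-∈ (suc k) cs j
  ...   | inj₁ empty = inj₁ empty
  ...   | inj₂ c′∈cs = inj₂ (there c′∈cs)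

  tag-IsConf! : ∀ k {ms} → All IsConf ms → IsConf! (tag k ms)
  tag-IsConf! k {ms} confs = components-IsConf! λ j →
    [ (λ empty → subst IsConf (sym empty) IsConfig-[]) , All.lookup confs ]′ (component-tag-∈ k ms j)

  s!-tag : ∀ k {ms} → All Inhabited ms → s! (tag k ms) ↭ ms
  s!-tag k {ms} inhabited = ↭-trans
    (↭.map⁺ (component x) (∼bag⇒↭ (unique∧set⇒bag (indices-unique x) (positions-unique k ms)
                                                   (mk⇔ indices⊆ ⊆indices))))
    (↭-reflexive (components-tag k ms))
    where
    x : List Ev!
    x = tag k ms
    indices⊆ : ∀ {j} → j ∈ indices x → j ∈ positions k ms
    indices⊆ j∈ with _ , a∈ ← ∈-indices⇒Inhabited j∈ = tag-positions ms (∈-component⁻ a∈)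
    ⊆indices : ∀ {j} → j ∈ positions k ms → j ∈ indices x
    ⊆indices {j} j∈ = Inhabited⇒∈-indices (All.lookup inhabited
      (subst (component x j ∈_) (components-tag k ms) (∈-map⁺ (component x) j∈)))

  s!-surjective : ∀ ms → All (λ c → IsConf c × Inhabited c × Complete c) ms →
                  ∃ λ x → IsConf! x × Complete! x × s! x ≋ ms
  s!-surjective ms valid =
    tag 0 ms , tag-IsConf! 0 confs ,
    Equivalence.from Complete!⇔components-Complete
      (All-resp-↭ (↭-sym s!↭ms) (All.map (proj₂ ∘ proj₂) valid)) ,
    ↭⇒Permutation (All-resp-↭ (↭-sym s!↭ms) (All.map ≅-refl confs)) s!↭ms
    where
    confs : All IsConf ms
    confs = All.map proj₁ valid
    s!↭ms : s! (tag 0 ms) ↭ ms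
    s!↭ms = s!-tag 0 (All.map (proj₁ ∘ proj₂) valid)

Strict⇒Complete-Inhabited : ∀ A → Strict A →
                            let open MinusGame A in ∀ {c} → Complete c → Inhabited c
Strict⇒Complete-Inhabited A (κ∅≡p1 , _) {[]} κ∅≡z0 with () ← ≡.trans (sym κ∅≡p1) κ∅≡z0
Strict⇒Complete-Inhabited A _ {e ∷ _} _ = e , here refl

lemma3p18 : (A : MinusGame) → let open Bang A in
    (∀ x → IsConf! x → Complete! x →
       All (λ c → IsConf c × Inhabited c × Complete c) (s! x))
    × (∀ x y → IsConf! x → Complete! x → IsConf! y → Complete! y →
       x ≅! y → s! x ≋ s! y)
    × (∀ x y → IsConf! x → Complete! x → IsConf! y → Complete! y →
       s! x ≋ s! y → x ≅! y)
    × (∀ ms → All (λ c → IsConf c × Inhabited c × Complete c) ms →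
       ∃ λ x → IsConf! x × Complete! x × s! x ≋ ms)
    × (∀ x → IsConf! x → Complete! x → Inhabited x ⇔ Inhabited (s! x))
    × (Strict A → ∀ ms → All (λ c → IsConf c × Complete c) ms →
       ∃ λ x → IsConf! x × Complete! x × s! x ≋ ms)
lemma3p18 A =
    (λ _ cx kx → components-valid cx kx)
  , (λ _ _ cx _ _ _ → ≅!⇒≋ cx)
  , (λ _ _ cx _ cy _ → ≋⇒≅! cx cy)
  , s!-surjective
  , (λ x _ _ → Inhabited⇔Inhabited-s! x)
  , λ strict ms valid → s!-surjective ms
      (All.map (λ (cc , kc) → cc , Strict⇒Complete-Inhabited A strict kc , kc) valid)
  where
  open Components A
  open Symmetries A
  open Tagging A
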